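{- Let $h\in\mathbb N$, $u,v\in\mathfrak S_n$, and let $F$ be an $h$-flipclass of paths from $u$ to $v$. Every vertex $(x,i)$ of $TS_F$ with $i>1$ has in-degree at least $2$ in $TS_F$, and every vertex $(x,i)$ of $TS_F$ with $i<h-1$ has out-degree at least $2$ in $TS_F$.
   Context: $\mathfrak S_n$: symmetric group on $[n]$, $\ell$ Coxeter length, $T$ transpositions. Bruhat graph: edge $x\xrightarrow{t}y$ whenever $yx^{ -1}=t\in T$ and $\ell(x)<\ell(y)$. $P_h(u,v)$: directed paths of length $h$ from $u$ to $v$. Between two elements there are 0 or 2 paths of length 2, each the flip of the other; for $i\in[h-1]$, $f_i:P_h(u,v)\to P_h(u,v)$ replaces the subpath $x_{i-1}\to x_i\to x_{i+1}$ by its flip; the $h$-flipclasses of paths from $u$ to $v$ are the orbits of the group generated by $f_1,\dots,f_{h-1}$. The time-support graph $TS_F$ has vertex set $\{(a,i):\exists(x_0\to\cdots\to x_h)\in F, x_i=a\}$ and an edge $(a,i)\to(b,i+1)$ whenever some path of $F$ has $x_i=a$ and $x_{i+1}=b$. -}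

module Defs where

open import Data.Nat using (ℕ; zero; suc; _<_; _<ᵇ_)
open import Data.Bool using (_∧_)
open import Data.Fin using (Fin; zero; suc; toℕ; inject₁; fromℕ)
open import Data.Fin.Permutation using (Permutation′; _⟨$⟩ʳ_; _≈_; transpose)
open import Data.List using (List; length; filterᵇ; concatMap; map; allFin)
open import Data.Product using (Σ; ∃; ∃-syntax; _×_; _,_)
open import Relation.Nullary using (¬_)
open import Relation.Binary.PropositionalEquality using (_≡_; _≢_)
open import Relation.Binary.Construct.Closure.ReflexiveTransitive using (Star)

-- The symmetric group on [n] = Fin n; elements compared up to pointwise
-- equality _≈_ (from Data.Fin.Permutation).
Perm : ℕ → Set
Perm n = Permutation′ n

ℓ : ∀ {n} → Perm n → ℕ
ℓ {n} σ = length (filterᵇ isInv pairs)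
  where
  pairs : List (Fin n × Fin n)
  pairs = concatMap (λ i → map (λ j → (i , j)) (allFin n)) (allFin n)
  isInv : Fin n × Fin n → _
  isInv (i , j) = (toℕ i <ᵇ toℕ j) ∧ (toℕ (σ ⟨$⟩ʳ j) <ᵇ toℕ (σ ⟨$⟩ʳ i))

-- y x⁻¹ = t for a transposition t = (a b), a ≠ b, i.e. y = t ∘ x.
TransposeStep : ∀ {n} → Perm n → Perm n → Set
TransposeStep {n} x y =
  ∃[ a ] ∃[ b ] (a ≢ b × (∀ k → y ⟨$⟩ʳ k ≡ transpose a b ⟨$⟩ʳ (x ⟨$⟩ʳ k)))

BEdge : ∀ {n} → Perm n → Perm n → Set
BEdge x y = TransposeStep x y × ℓ x < ℓ y

Seq : ℕ → ℕ → Set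
Seq n h = Fin (suc h) → Perm n

IsPath : ∀ {n} (h : ℕ) → Perm n → Perm n → Seq n h → Set
IsPath h u v x =
  (x zero ≈ u) × (x (fromℕ h) ≈ v) ×
  (∀ (i : Fin h) → BEdge (x (inject₁ i)) (x (suc i)))

-- f_i (i ∈ [h-1]) sends path x to y: y is the path obtained by replacing
-- x_{i-1} → x_i → x_{i+1} with its flip, the other path of length 2
-- between x_{i-1} and x_{i+1}.
Flip : ∀ {n} (h : ℕ) → Perm n → Perm n → Fin (suc h) → Seq n h → Seq n h → Set
Flip h u v i x y =
  IsPath h u v x × IsPath h u v y ×
  0 < toℕ i × toℕ i < h ×
  (∀ j → j ≢ i → x j ≈ y j) × ¬ (x i ≈ y i)

FlipStep : ∀ {n} (h : ℕ) → Perm n → Perm n → Seq n h → Seq n h → Set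
FlipStep h u v x y = ∃[ i ] Flip h u v i x y

-- The h-flipclass F of a path p ∈ P_h(u,v): its orbit under ⟨f_1,…,f_{h-1}⟩
-- (the f_i are involutions, so the orbit is the reflexive-transitive closure).
FlipClass : ∀ {n} (h : ℕ) → Perm n → Perm n → Seq n h → Seq n h → Set
FlipClass h u v p q = Star (FlipStep h u v) p q

TSVertex : ∀ {n h} → (Seq n h → Set) → Perm n → Fin (suc h) → Set
TSVertex F a i = ∃[ q ] (F q × q i ≈ a)

TSEdge : ∀ {n h} → (Seq n h → Set) → Perm n → Fin (suc h) → Perm n → Fin (suc h) → Set
TSEdge F a i b j = toℕ j ≡ suc (toℕ i) × ∃[ q ] (F q × q i ≈ a × q j ≈ b)

InDeg≥2 : ∀ {n h} → (Seq n h → Set) → Perm n → Fin (suc h) → Set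
InDeg≥2 F b j = ∃[ a₁ ] ∃[ i₁ ] ∃[ a₂ ] ∃[ i₂ ]
  (¬ (a₁ ≈ a₂) × TSEdge F a₁ i₁ b j × TSEdge F a₂ i₂ b j)

OutDeg≥2 : ∀ {n h} → (Seq n h → Set) → Perm n → Fin (suc h) → Set
OutDeg≥2 F a i = ∃[ b₁ ] ∃[ j₁ ] ∃[ b₂ ] ∃[ j₂ ]
  (¬ (b₁ ≈ b₂) × TSEdge F a i b₁ j₁ × TSEdge F a i b₂ j₂)

-- The heart of the matter is that a Bruhat path x → y → z of length two always has a second one
-- x → y′ → z.  Write y = (a b) x and z = (c d) y.  Counting inversions shows that x → (a b) x is an
-- edge exactly when the positions of a and b in x come in the same order as a and b.  If {a, b} and
-- {c, d} are disjoint, the two transpositions commute and y′ = (c d) x.  If they share a letter,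
-- (c d) (a b) is a 3-cycle, which has two other factorisations into two transpositions, and comparing
-- the order of the three letters with the order of their positions shows that one of them ascends
-- twice.  ({c, d} = {a, b} is impossible, as then z = x.)  Hence every inner vertex of a path can be
-- flipped, and for a vertex (x, i) of TS_F a path through it together with its flip at i - 1
-- (resp. i + 1) yields two distinct in- (resp. out-) neighbours.
module Submission where

open import Defs
open import Data.Bool as Bool using (Bool; true; false; _∧_; not; T)
open import Data.Bool.Properties using (∧-comm; ¬-not; T-≡; T-not-≡; T-∧)
open import Data.Empty using (⊥-elim)
open import Data.Fin using (Fin; zero; suc; toℕ; inject₁; fromℕ; fromℕ<; _≟_)
open import Data.Fin.Permutation
  using (Permutation′; _⟨$⟩ʳ_; _⟨$⟩ˡ_; inverseˡ; inverseʳ; transpose; _∘ₚ_; _≈_)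
import Data.Fin.Permutation.Components as PC
open import Data.Fin.Properties
  using (toℕ-injective; suc-injective; inject₁-injective; toℕ-inject₁; toℕ<n; toℕ-fromℕ<; fromℕ≢inject₁)
open import Data.List using (List; _++_; length; filterᵇ; concatMap; map; tabulate; allFin)
import Data.List.Properties as List
open import Data.Nat using (ℕ; zero; suc; _+_; _<_; _≤_; _∸_; _<ᵇ_; z≤n; s≤s)
open import Data.Nat.Properties
  using ( +-0-commutativeMonoid; +-identityʳ; +-mono-≤; +-mono-<-≤; +-mono-≤-<
        ; ≤-reflexive; ≤-trans; ≮⇒≥; ≤⇒≯; <-trans; <-asym; <-irrefl; <-cmp; n<1+n; <⇒<ᵇ; <ᵇ⇒<
        ; module ≤-Reasoning)
open import Algebra.Properties.CommutativeMonoid.Sum +-0-commutativeMonoid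
  using (sum; sum-syntax; sum-cong-≗; ∑-distrib-+; ∑-permute)
open import Data.Product using (_×_; _,_; ∃-syntax; proj₁; proj₂; uncurry)
open import Data.Sum using (_⊎_; inj₁; inj₂; [_,_]′)
open import Data.Unit using (tt)
open import Data.Vec.Functional using (updateAt)
open import Data.Vec.Functional.Properties using (updateAt-updates; updateAt-minimal)
open import Function using (_∘_; id)
open import Function.Bundles using (Equivalence; _⇔_; mk⇔)
open import Function.Definitions using (Injective)
open import Relation.Binary.Construct.Closure.ReflexiveTransitive using (ε; _◅_; _◅◅_)
open import Relation.Binary.Definitions using (tri<; tri≈; tri>)
open import Relation.Binary.PropositionalEquality
open import Relation.Nullary using (¬_; yes; no; contradiction)
open import Relation.Nullary.Decidable using (T?)

𝟙 : Bool → ℕ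
𝟙 true  = 1
𝟙 false = 0

𝟙-split : ∀ a b c → 𝟙 (a ∧ b) ≡ 𝟙 ((a ∧ c) ∧ b) + 𝟙 ((a ∧ not c) ∧ b)
𝟙-split false b c     = refl
𝟙-split true  b true  = sym (+-identityʳ (𝟙 b))
𝟙-split true  b false = refl

𝟙-∧-mono : ∀ {a b c} → (T a → T b → T c) → 𝟙 (a ∧ b) ≤ 𝟙 (a ∧ c)
𝟙-∧-mono {false}                _    = z≤n
𝟙-∧-mono {true} {false}         _    = z≤n
𝟙-∧-mono {true} {true}  {true}  _    = s≤s z≤n
𝟙-∧-mono {true} {true}  {false} ab⇒c = ⊥-elim (ab⇒c tt tt)

∑-mono-≤ : ∀ {m} {f g : Fin m → ℕ} → (∀ k → f k ≤ g k) → sum f ≤ sum g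
∑-mono-≤ {zero}  f≤g = z≤n
∑-mono-≤ {suc m} f≤g = +-mono-≤ (f≤g zero) (∑-mono-≤ (f≤g ∘ suc))

∑-mono-< : ∀ {m} {f g : Fin m → ℕ} (i : Fin m) → (∀ k → f k ≤ g k) → f i < g i → sum f < sum g
∑-mono-< zero    f≤g fi<gi = +-mono-<-≤ fi<gi (∑-mono-≤ (f≤g ∘ suc))
∑-mono-< (suc i) f≤g fi<gi = +-mono-≤-< (f≤g zero) (∑-mono-< i (f≤g ∘ suc) fi<gi)

∑∑-permute : ∀ {m} (π : Permutation′ m) (F : Fin m → Fin m → ℕ) →
  ∑[ k < m ] ∑[ l < m ] F k l ≡ ∑[ k < m ] ∑[ l < m ] F (π ⟨$⟩ʳ k) (π ⟨$⟩ʳ l)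
∑∑-permute π F = trans (sum-cong-≗ λ k → ∑-permute (F k) π) (∑-permute _ π)

<ᵇ-true : ∀ {m n} → m < n → (m <ᵇ n) ≡ true
<ᵇ-true m<n = Equivalence.to T-≡ (<⇒<ᵇ m<n)

<ᵇ-false : ∀ {m n} → m < n → (n <ᵇ m) ≡ false
<ᵇ-false {m} {n} m<n with n <ᵇ m in n<ᵇm
... | false = refl
... | true  = ⊥-elim (<-asym m<n (<ᵇ⇒< n m (subst T (sym n<ᵇm) tt)))

<ᵇ-flip : ∀ {m n} → m ≢ n → (n <ᵇ m) ≡ not (m <ᵇ n)
<ᵇ-flip {m} {n} m≢n with <-cmp m n
... | tri< m<n _ _ = trans (<ᵇ-false m<n) (cong not (sym (<ᵇ-true m<n)))
... | tri≈ _ m≡n _ = ⊥-elim (m≢n m≡n)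
... | tri> _ _ n<m = trans (<ᵇ-true n<m) (cong not (sym (<ᵇ-false n<m)))

<ᵇ-median : ∀ l m n → (l <ᵇ m) ≡ (m <ᵇ n) → (l <ᵇ n) ≡ (l <ᵇ m)
<ᵇ-median l m n lm≡mn with l <ᵇ m in lm | l <ᵇ n in ln
... | true  | true  = refl
... | false | false = refl
... | true  | false =
  contradiction (<⇒<ᵇ (<-trans (<ᵇ⇒< l m (subst T (sym lm) tt)) (<ᵇ⇒< m n (subst T lm≡mn tt)))) (subst T ln)
... | false | true  =
  contradiction (<ᵇ⇒< l n (subst T (sym ln) tt))
                (≤⇒≯ (≤-trans (≮⇒≥ (subst T (sym lm≡mn) ∘ <⇒<ᵇ)) (≮⇒≥ (subst T lm ∘ <⇒<ᵇ))))

infix 4 _≺_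

_≺_ : ∀ {n} → Fin n → Fin n → Bool
i ≺ j = toℕ i <ᵇ toℕ j

-- Transpositions

data TransposeView {n} (i j : Fin n) : Fin n → Fin n → Set where
  at-i  : TransposeView i j i j
  at-j  : TransposeView i j j i
  other : ∀ {k} → k ≢ i → k ≢ j → TransposeView i j k k

transpose-view : ∀ {n} (i j k : Fin n) → TransposeView i j k (PC.transpose i j k)
transpose-view i j k with k ≟ i
... | yes refl = at-i
... | no k≢i with k ≟ j
...   | yes refl = at-j
...   | no k≢j   = other k≢i k≢j

module _ {n} (i j : Fin n) where

  transpose-matchˡ : PC.transpose i j i ≡ j
  transpose-matchˡ with PC.transpose i j i | transpose-view i j i
  ... | _ | at-i        = refl
  ... | _ | at-j        = refl
  ... | _ | other i≢i _ = ⊥-elim (i≢i refl)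

  transpose-matchʳ : PC.transpose i j j ≡ i
  transpose-matchʳ with PC.transpose i j j | transpose-view i j j
  ... | _ | at-i        = refl
  ... | _ | at-j        = refl
  ... | _ | other _ j≢j = ⊥-elim (j≢j refl)

  transpose-fixes : ∀ {k} → k ≢ i → k ≢ j → PC.transpose i j k ≡ k
  transpose-fixes {k} k≢i k≢j with PC.transpose i j k | transpose-view i j k
  ... | _ | at-i      = ⊥-elim (k≢i refl)
  ... | _ | at-j      = ⊥-elim (k≢j refl)
  ... | _ | other _ _ = refl

  transpose-involutive : ∀ k → PC.transpose i j (PC.transpose i j k) ≡ k
  transpose-involutive k with PC.transpose i j k | transpose-view i j k
  ... | _ | at-i          = transpose-matchʳ
  ... | _ | at-j          = transpose-matchˡ
  ... | _ | other k≢i k≢j = transpose-fixes k≢i k≢j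

  transpose-injective : Injective _≡_ _≡_ (PC.transpose i j)
  transpose-injective {k} {l} tk≡tl =
    trans (sym (transpose-involutive k)) (trans (cong (PC.transpose i j) tk≡tl) (transpose-involutive l))

transpose-comm : ∀ {n} (i j k : Fin n) → PC.transpose i j k ≡ PC.transpose j i k
transpose-comm i j k with PC.transpose i j k | transpose-view i j k
... | _ | at-i          = sym (transpose-matchʳ j i)
... | _ | at-j          = sym (transpose-matchˡ j i)
... | _ | other k≢i k≢j = sym (transpose-fixes j i k≢j k≢i)

transpose-conjugate : ∀ {n m} (σ : Fin n → Fin m) → Injective _≡_ _≡_ σ → ∀ i j k →
  σ (PC.transpose i j k) ≡ PC.transpose (σ i) (σ j) (σ k)
transpose-conjugate σ σ-inj i j k with PC.transpose i j k | transpose-view i j k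
... | _ | at-i          = sym (transpose-matchˡ (σ i) (σ j))
... | _ | at-j          = sym (transpose-matchʳ (σ i) (σ j))
... | _ | other k≢i k≢j = sym (transpose-fixes (σ i) (σ j) (k≢i ∘ σ-inj) (k≢j ∘ σ-inj))

transpose-conjugate-transpose : ∀ {n} (a b i j k : Fin n) → PC.transpose a b (PC.transpose i j k)
  ≡ PC.transpose (PC.transpose a b i) (PC.transpose a b j) (PC.transpose a b k)
transpose-conjugate-transpose a b = transpose-conjugate (PC.transpose a b) (transpose-injective a b)

module _ {n} {p q r : Fin n} (p≢q : p ≢ q) (q≢r : q ≢ r) (p≢r : p ≢ r) where

  transpose-cycleˡ : ∀ w → PC.transpose q r (PC.transpose p q w) ≡ PC.transpose p q (PC.transpose p r w)
  transpose-cycleˡ w = sym (trans (transpose-conjugate-transpose p q p r w)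
    (cong₂ (λ c d → PC.transpose c d (PC.transpose p q w))
           (transpose-matchˡ p q) (transpose-fixes p q (p≢r ∘ sym) (q≢r ∘ sym))))

  transpose-cycleʳ : ∀ w → PC.transpose q r (PC.transpose p q w) ≡ PC.transpose p r (PC.transpose q r w)
  transpose-cycleʳ w = trans (transpose-conjugate-transpose q r p q w)
    (cong₂ (λ c d → PC.transpose c d (PC.transpose q r w)) (transpose-fixes q r p≢q p≢r) (transpose-matchˡ q r))

transpose-comm-disjoint : ∀ {n} {a b c d : Fin n} → a ≢ c → a ≢ d → b ≢ c → b ≢ d →
  ∀ w → PC.transpose c d (PC.transpose a b w) ≡ PC.transpose a b (PC.transpose c d w)
transpose-comm-disjoint {a = a} {b} {c} {d} a≢c a≢d b≢c b≢d w = trans (transpose-conjugate-transpose c d a b w)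
  (cong₂ (λ e f → PC.transpose e f (PC.transpose c d w)) (transpose-fixes c d a≢c a≢d) (transpose-fixes c d b≢c b≢d))

-- Inversions

inversions : ∀ {m} → (Fin m → ℕ) → ℕ
inversions {m} f = ∑[ k < m ] ∑[ l < m ] 𝟙 ((k ≺ l) ∧ (f l <ᵇ f k))

inversionsWhere : ∀ {m} → (Fin m → Fin m → Bool) → (Fin m → ℕ) → ℕ
inversionsWhere {m} c f = ∑[ k < m ] ∑[ l < m ] 𝟙 (((k ≺ l) ∧ c k l) ∧ (f l <ᵇ f k))

inversions-cong : ∀ {m} {f g : Fin m → ℕ} → f ≗ g → inversions f ≡ inversions g
inversions-cong f≗g = sum-cong-≗ λ k → sum-cong-≗ λ l → cong₂ (λ a b → 𝟙 ((k ≺ l) ∧ (a <ᵇ b))) (f≗g l) (f≗g k)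

inversions-split : ∀ {m} (c : Fin m → Fin m → Bool) (f : Fin m → ℕ) →
  inversions f ≡ inversionsWhere c f + inversionsWhere (λ k l → not (c k l)) f
inversions-split {m} c f = begin
  inversions f
    ≡⟨ sum-cong-≗ (λ k → sum-cong-≗ λ l → 𝟙-split (k ≺ l) (f l <ᵇ f k) (c k l)) ⟩
  ∑[ k < m ] ∑[ l < m ] (kept k l + dropped k l)
    ≡⟨ sum-cong-≗ (λ k → ∑-distrib-+ (kept k) (dropped k)) ⟩
  ∑[ k < m ] (∑[ l < m ] kept k l + ∑[ l < m ] dropped k l)
    ≡⟨ ∑-distrib-+ (λ k → ∑[ l < m ] kept k l) (λ k → ∑[ l < m ] dropped k l) ⟩
  inversionsWhere c f + inversionsWhere (λ k l → not (c k l)) f ∎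
  where
  open ≡-Reasoning
  kept dropped : Fin m → Fin m → ℕ
  kept    k l = 𝟙 (((k ≺ l) ∧ c k l) ∧ (f l <ᵇ f k))
  dropped k l = 𝟙 (((k ≺ l) ∧ not (c k l)) ∧ (f l <ᵇ f k))

-- The inversions of f are split according to whether τ preserves the order of the pair.  τ maps the
-- preserved pairs bijectively onto themselves, matching the inversions of f ∘ τ with those of f.  The
-- reversed pairs are (i, j), (i, m) and (m, j) with i < m < j; on them f ∘ τ has every inversion of f,
-- and (i, j) besides.
module _ {m} {i j : Fin m} (f : Fin m → ℕ) where

  private
    τ : Fin m → Fin m
    τ = PC.transpose i j

    preserved reversed : Fin m → Fin m → Bool
    preserved k l = τ k ≺ τ l
    reversed  k l = not (preserved k l)

  inversionsWhere-preserved-transpose : inversionsWhere preserved (f ∘ τ) ≡ inversionsWhere preserved f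
  inversionsWhere-preserved-transpose =
    trans (∑∑-permute (transpose i j) _) (sum-cong-≗ λ k → sum-cong-≗ λ l → swapped k l)
    where
    swapped : ∀ k l → 𝟙 (((τ k ≺ τ l) ∧ preserved (τ k) (τ l)) ∧ (f (τ (τ l)) <ᵇ f (τ (τ k))))
                    ≡ 𝟙 (((k ≺ l) ∧ preserved k l) ∧ (f l <ᵇ f k))
    swapped k l rewrite transpose-involutive i j k | transpose-involutive i j l =
      cong (λ b → 𝟙 (b ∧ (f l <ᵇ f k))) (∧-comm (τ k ≺ τ l) (k ≺ l))

  transpose-reversed-pair : ∀ {k k′ l l′} → TransposeView i j k k′ → TransposeView i j l l′ →
    toℕ i < toℕ j → f i < f j → toℕ k < toℕ l → ¬ toℕ k′ < toℕ l′ → f l < f k → f l′ < f k′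
  transpose-reversed-pair at-i        at-i        _   _     k<l _   _     = ⊥-elim (<-irrefl refl k<l)
  transpose-reversed-pair at-i        at-j        _   fi<fj _   _   _     = fi<fj
  transpose-reversed-pair at-i        (other _ _) _   fi<fj _   _   fl<fk = <-trans fl<fk fi<fj
  transpose-reversed-pair at-j        at-i        i<j _     k<l _   _     = ⊥-elim (<-asym i<j k<l)
  transpose-reversed-pair at-j        at-j        _   _     k<l _   _     = ⊥-elim (<-irrefl refl k<l)
  transpose-reversed-pair at-j        (other _ _) i<j _     k<l i≮l _     = ⊥-elim (i≮l (<-trans i<j k<l))
  transpose-reversed-pair (other _ _) at-i        i<j _     k<l k≮j _     = ⊥-elim (k≮j (<-trans k<l i<j))
  transpose-reversed-pair (other _ _) at-j        _   fi<fj _   _   fl<fk = <-trans fi<fj fl<fk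
  transpose-reversed-pair (other _ _) (other _ _) _   _     k<l k≮l _     = ⊥-elim (k≮l k<l)

  module _ (i<j : toℕ i < toℕ j) (fi<fj : f i < f j) where

    inversionsWhere-reversed-transpose : inversionsWhere reversed f < inversionsWhere reversed (f ∘ τ)
    inversionsWhere-reversed-transpose = ∑-mono-< i (λ k → ∑-mono-≤ (pointwise k)) (∑-mono-< j (pointwise i) at-ij)
      where
      pointwise : ∀ k l → 𝟙 (((k ≺ l) ∧ reversed k l) ∧ (f l <ᵇ f k))
                        ≤ 𝟙 (((k ≺ l) ∧ reversed k l) ∧ (f (τ l) <ᵇ f (τ k)))
      pointwise k l = 𝟙-∧-mono λ k≺l∧rev fl<fk →
        let k≺l , rev = Equivalence.to T-∧ k≺l∧rev
        in <⇒<ᵇ (transpose-reversed-pair (transpose-view i j k) (transpose-view i j l) i<j fi<fj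
                   (<ᵇ⇒< _ _ k≺l) (λ τk<τl → subst T (Equivalence.to T-not-≡ rev) (<⇒<ᵇ τk<τl))
                   (<ᵇ⇒< _ _ fl<fk))
      at-ij : 𝟙 (((i ≺ j) ∧ reversed i j) ∧ (f j <ᵇ f i)) < 𝟙 (((i ≺ j) ∧ reversed i j) ∧ (f (τ j) <ᵇ f (τ i)))
      at-ij rewrite transpose-matchˡ i j | transpose-matchʳ i j
                  | <ᵇ-true i<j | <ᵇ-false i<j | <ᵇ-true fi<fj | <ᵇ-false fi<fj = s≤s z≤n

    inversions-transpose-< : inversions f < inversions (f ∘ τ)
    inversions-transpose-< = begin-strict
      inversions f
        ≡⟨ inversions-split preserved f ⟩
      inversionsWhere preserved f + inversionsWhere reversed f
        <⟨ +-mono-≤-< (≤-reflexive (sym inversionsWhere-preserved-transpose)) inversionsWhere-reversed-transpose ⟩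
      inversionsWhere preserved (f ∘ τ) + inversionsWhere reversed (f ∘ τ)
        ≡⟨ inversions-split preserved (f ∘ τ) ⟨
      inversions (f ∘ τ) ∎
      where open ≤-Reasoning

inversions-transpose-agreeing : ∀ {m} (f : Fin m → ℕ) {i j : Fin m} → i ≢ j → f i ≢ f j →
  (i ≺ j) ≡ (f i <ᵇ f j) → inversions f < inversions (f ∘ PC.transpose i j)
inversions-transpose-agreeing f {i} {j} i≢j fi≢fj agree with <-cmp (toℕ i) (toℕ j)
... | tri< i<j _ _ = inversions-transpose-< f i<j (<ᵇ⇒< _ _ (subst T (trans (sym (<ᵇ-true i<j)) agree) tt))
... | tri≈ _ i≡j _ = ⊥-elim (i≢j (toℕ-injective i≡j))
... | tri> _ _ j<i = begin-strict
  inversions f                      <⟨ inversions-transpose-< f j<i fj<fi ⟩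
  inversions (f ∘ PC.transpose j i) ≡⟨ inversions-cong (cong f ∘ transpose-comm j i) ⟩
  inversions (f ∘ PC.transpose i j) ∎
  where
  open ≤-Reasoning
  fj<fi : f j < f i
  fj<fi = <ᵇ⇒< _ _ (subst T (sym (trans (<ᵇ-flip fi≢fj) (cong not (trans (sym agree) (<ᵇ-false j<i))))) tt)

inversions-transpose-<⇔ : ∀ {m} (f : Fin m → ℕ) {i j : Fin m} → i ≢ j → f i ≢ f j →
  inversions f < inversions (f ∘ PC.transpose i j) ⇔ ((i ≺ j) ≡ (f i <ᵇ f j))
inversions-transpose-<⇔ f {i} {j} i≢j fi≢fj = mk⇔ agreeing (inversions-transpose-agreeing f i≢j fi≢fj)
  where
  τ : Fin _ → Fin _
  τ = PC.transpose i j
  agreeing : inversions f < inversions (f ∘ τ) → (i ≺ j) ≡ (f i <ᵇ f j)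
  agreeing f<fτ with (i ≺ j) Bool.≟ (f i <ᵇ f j)
  ... | yes agree   = agree
  ... | no disagree = ⊥-elim (<-asym f<fτ (begin-strict
    inversions (f ∘ τ)     <⟨ inversions-transpose-agreeing (f ∘ τ) i≢j fτi≢fτj agree-τ ⟩
    inversions (f ∘ τ ∘ τ) ≡⟨ inversions-cong (cong f ∘ transpose-involutive i j) ⟩
    inversions f           ∎))
    where
    open ≤-Reasoning
    fτi≡fj : f (τ i) ≡ f j
    fτi≡fj = cong f (transpose-matchˡ i j)
    fτj≡fi : f (τ j) ≡ f i
    fτj≡fi = cong f (transpose-matchʳ i j)
    fτi≢fτj : f (τ i) ≢ f (τ j)
    fτi≢fτj e = fi≢fj (trans (sym fτj≡fi) (trans (sym e) fτi≡fj))
    agree-τ : (i ≺ j) ≡ (f (τ i) <ᵇ f (τ j))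
    agree-τ = trans (¬-not disagree) (trans (sym (<ᵇ-flip fi≢fj)) (sym (cong₂ _<ᵇ_ fτi≡fj fτj≡fi)))

-- The length as an inversion count

length-filterᵇ-tabulate : ∀ {A : Set} (P : A → Bool) {m} (f : Fin m → A) →
  length (filterᵇ P (tabulate f)) ≡ ∑[ k < m ] 𝟙 (P (f k))
length-filterᵇ-tabulate P {zero}  f = refl
length-filterᵇ-tabulate P {suc m} f with P (f zero)
... | true  = cong suc (length-filterᵇ-tabulate P (f ∘ suc))
... | false = length-filterᵇ-tabulate P (f ∘ suc)

length-filterᵇ-concatMap-tabulate : ∀ {A B : Set} (P : B → Bool) (G : A → List B) {m} (f : Fin m → A) →
  length (filterᵇ P (concatMap G (tabulate f))) ≡ ∑[ k < m ] length (filterᵇ P (G (f k)))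
length-filterᵇ-concatMap-tabulate P G {zero}  f = refl
length-filterᵇ-concatMap-tabulate P G {suc m} f = begin
  length (filterᵇ P (G (f zero) ++ rest))
    ≡⟨ cong length (List.filter-++ (T? ∘ P) (G (f zero)) rest) ⟩
  length (filterᵇ P (G (f zero)) ++ filterᵇ P rest)
    ≡⟨ List.length-++ (filterᵇ P (G (f zero))) ⟩
  length (filterᵇ P (G (f zero))) + length (filterᵇ P rest)
    ≡⟨ cong (length (filterᵇ P (G (f zero))) +_) (length-filterᵇ-concatMap-tabulate P G (f ∘ suc)) ⟩
  ∑[ k < suc m ] length (filterᵇ P (G (f k))) ∎
  where
  open ≡-Reasoning
  rest = concatMap G (tabulate (f ∘ suc))

length-filterᵇ-allPairs : ∀ {n} (P : Fin n × Fin n → Bool) →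
  length (filterᵇ P (concatMap (λ k → map (k ,_) (allFin n)) (allFin n))) ≡ ∑[ k < n ] ∑[ l < n ] 𝟙 (P (k , l))
length-filterᵇ-allPairs {n} P =
  trans (length-filterᵇ-concatMap-tabulate P (λ k → map (k ,_) (allFin n)) id) (sum-cong-≗ λ k →
    trans (cong (length ∘ filterᵇ P) (List.map-tabulate id (k ,_))) (length-filterᵇ-tabulate P (k ,_)))

ℓ≡inversions : ∀ {n} (σ : Perm n) → ℓ σ ≡ inversions (toℕ ∘ (σ ⟨$⟩ʳ_))
ℓ≡inversions {n} σ = length-filterᵇ-allPairs {n} _

ℓ-cong : ∀ {n} {x y : Perm n} → x ≈ y → ℓ x ≡ ℓ y
ℓ-cong {x = x} {y} x≈y = trans (ℓ≡inversions x) (trans (inversions-cong (cong toℕ ∘ x≈y)) (sym (ℓ≡inversions y)))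

ℓ<⇒≉ : ∀ {n} {x z : Perm n} → ℓ x < ℓ z → ¬ z ≈ x
ℓ<⇒≉ {x = x} {z} x<z z≈x = <-irrefl (sym (ℓ-cong {x = z} {x} z≈x)) x<z

-- Bruhat edges

⟨$⟩ʳ-injective : ∀ {n} (x : Perm n) → Injective _≡_ _≡_ (x ⟨$⟩ʳ_)
⟨$⟩ʳ-injective x xa≡xb = trans (sym (inverseˡ x)) (trans (cong (x ⟨$⟩ˡ_) xa≡xb) (inverseˡ x))

⟨$⟩ˡ-injective : ∀ {n} (x : Perm n) → Injective _≡_ _≡_ (x ⟨$⟩ˡ_)
⟨$⟩ˡ-injective x x⁻¹a≡x⁻¹b = trans (sym (inverseʳ x)) (trans (cong (x ⟨$⟩ʳ_) x⁻¹a≡x⁻¹b) (inverseʳ x))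

-- A record rather than a function type, so that x and y can be inferred from it.
record Transposes {n} (a b : Fin n) (x y : Perm n) : Set where
  constructor transposes
  field pointwise : ∀ k → y ⟨$⟩ʳ k ≡ transpose a b ⟨$⟩ʳ (x ⟨$⟩ʳ k)

open Transposes

Ascent : ∀ {n} → Perm n → Fin n → Fin n → Set
Ascent x a b = (x ⟨$⟩ˡ a ≺ x ⟨$⟩ˡ b) ≡ (a ≺ b)

ℓ<⇔Ascent : ∀ {n} {x y : Perm n} {a b} → a ≢ b → Transposes a b x y → ℓ x < ℓ y ⇔ Ascent x a b
ℓ<⇔Ascent {x = x} {y} {a} {b} a≢b y≡tx =
  subst₂ (λ ℓx ℓy → ℓx < ℓy ⇔ Ascent x a b) (sym (ℓ≡inversions x)) (sym ℓy≡inversions)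
    (subst (λ c → inversions f < inversions (f ∘ PC.transpose i j) ⇔ ((i ≺ j) ≡ c)) fi<ᵇfj≡a≺b
      (inversions-transpose-<⇔ f i≢j fi≢fj))
  where
  i j : Fin _
  i = x ⟨$⟩ˡ a
  j = x ⟨$⟩ˡ b
  f : Fin _ → ℕ
  f = toℕ ∘ (x ⟨$⟩ʳ_)
  xi≡a : x ⟨$⟩ʳ i ≡ a
  xi≡a = inverseʳ x
  xj≡b : x ⟨$⟩ʳ j ≡ b
  xj≡b = inverseʳ x
  i≢j : i ≢ j
  i≢j = a≢b ∘ ⟨$⟩ˡ-injective x
  fi≢fj : f i ≢ f j
  fi≢fj = a≢b ∘ subst₂ _≡_ xi≡a xj≡b ∘ toℕ-injective
  fi<ᵇfj≡a≺b : (f i <ᵇ f j) ≡ (a ≺ b)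
  fi<ᵇfj≡a≺b = cong₂ _≺_ xi≡a xj≡b
  y≡xτ : ∀ k → y ⟨$⟩ʳ k ≡ x ⟨$⟩ʳ (PC.transpose i j k)
  y≡xτ k = begin
    y ⟨$⟩ʳ k                                       ≡⟨ pointwise y≡tx k ⟩
    PC.transpose a b (x ⟨$⟩ʳ k)                    ≡⟨ cong₂ (λ c d → PC.transpose c d (x ⟨$⟩ʳ k)) xi≡a xj≡b ⟨
    PC.transpose (x ⟨$⟩ʳ i) (x ⟨$⟩ʳ j) (x ⟨$⟩ʳ k) ≡⟨ transpose-conjugate (x ⟨$⟩ʳ_) (⟨$⟩ʳ-injective x) i j k ⟨
    x ⟨$⟩ʳ (PC.transpose i j k)                    ∎
    where open ≡-Reasoning
  ℓy≡inversions : ℓ y ≡ inversions (f ∘ PC.transpose i j)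
  ℓy≡inversions = trans (ℓ≡inversions y) (inversions-cong (cong toℕ ∘ y≡xτ))

module _ {n} {x y : Perm n} {a b : Fin n} (a≢b : a ≢ b) (y≡tx : Transposes a b x y) where

  BEdge-fromAscent : Ascent x a b → BEdge x y
  BEdge-fromAscent ascent = (a , b , a≢b , pointwise y≡tx) , Equivalence.from (ℓ<⇔Ascent a≢b y≡tx) ascent

  Ascent-fromℓ< : ℓ x < ℓ y → Ascent x a b
  Ascent-fromℓ< = Equivalence.to (ℓ<⇔Ascent a≢b y≡tx)

module _ {n} {x y : Perm n} {a b : Fin n} (y≡tx : Transposes a b x y) where

  Transposes-sym : Transposes b a x y
  Transposes-sym = transposes λ k → trans (pointwise y≡tx k) (transpose-comm a b (x ⟨$⟩ʳ k))

  Transposes-twice : ∀ {z} → Transposes a b y z → z ≈ x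
  Transposes-twice z≡ty k =
    trans (pointwise z≡ty k) (trans (cong (PC.transpose a b) (pointwise y≡tx k)) (transpose-involutive a b (x ⟨$⟩ʳ k)))

  Transposes-matchˡ : y ⟨$⟩ʳ (x ⟨$⟩ˡ a) ≡ b
  Transposes-matchˡ = trans (pointwise y≡tx _) (trans (cong (PC.transpose a b) (inverseʳ x)) (transpose-matchˡ a b))

  Transposes-fixes : ∀ {c} → c ≢ a → c ≢ b → y ⟨$⟩ʳ (x ⟨$⟩ˡ c) ≡ c
  Transposes-fixes c≢a c≢b =
    trans (pointwise y≡tx _) (trans (cong (PC.transpose a b) (inverseʳ x)) (transpose-fixes a b c≢a c≢b))

  Transposes-⟨$⟩ˡ : ∀ c → y ⟨$⟩ˡ c ≡ x ⟨$⟩ˡ (PC.transpose a b c)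
  Transposes-⟨$⟩ˡ c = ⟨$⟩ʳ-injective y (begin
    y ⟨$⟩ʳ (y ⟨$⟩ˡ c)                                     ≡⟨ inverseʳ y ⟩
    c                                                    ≡⟨ transpose-involutive a b c ⟨
    PC.transpose a b (PC.transpose a b c)                ≡⟨ cong (PC.transpose a b) (inverseʳ x) ⟨
    PC.transpose a b (x ⟨$⟩ʳ (x ⟨$⟩ˡ PC.transpose a b c)) ≡⟨ pointwise y≡tx _ ⟨
    y ⟨$⟩ʳ (x ⟨$⟩ˡ PC.transpose a b c)                     ∎)
    where open ≡-Reasoning

  Transposes-⟨$⟩ˡ-matchˡ : y ⟨$⟩ˡ a ≡ x ⟨$⟩ˡ b
  Transposes-⟨$⟩ˡ-matchˡ = trans (Transposes-⟨$⟩ˡ a) (cong (x ⟨$⟩ˡ_) (transpose-matchˡ a b))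

  Transposes-⟨$⟩ˡ-matchʳ : y ⟨$⟩ˡ b ≡ x ⟨$⟩ˡ a
  Transposes-⟨$⟩ˡ-matchʳ = trans (Transposes-⟨$⟩ˡ b) (cong (x ⟨$⟩ˡ_) (transpose-matchʳ a b))

  Transposes-⟨$⟩ˡ-fixes : ∀ {c} → c ≢ a → c ≢ b → y ⟨$⟩ˡ c ≡ x ⟨$⟩ˡ c
  Transposes-⟨$⟩ˡ-fixes c≢a c≢b = trans (Transposes-⟨$⟩ˡ _) (cong (x ⟨$⟩ˡ_) (transpose-fixes a b c≢a c≢b))

-- Paths of length two come in pairs

SecondPath : ∀ {n} → Perm n → Perm n → Perm n → Set
SecondPath x y z = ∃[ y′ ] (BEdge x y′ × BEdge y′ z × ¬ y ≈ y′)

-- α, β, γ compare the letters p, q; q, r; p, r and A, B, C compare their positions in x.  The first two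
-- hypotheses are transitivity, the last two say that x → (p q) x → (q r) (p q) x ascends twice, and the
-- conclusion says that (p r) x or (q r) x can serve as the middle vertex instead.
cycle-choice : ∀ {α β γ A B C : Bool} → (α ≡ β → γ ≡ α) → (A ≡ B → C ≡ A) → A ≡ α → C ≡ β →
  (C ≡ γ × not B ≡ α) ⊎ (B ≡ β × A ≡ γ)
cycle-choice {true}  {true}  {true}  {B = true}  _  _  refl refl = inj₂ (refl , refl)
cycle-choice {true}  {true}  {true}  {B = false} _  _  refl refl = inj₁ (refl , refl)
cycle-choice {true}  {true}  {false}             αβ _  refl refl = contradiction (αβ refl) λ ()
cycle-choice {true}  {false}         {B = true}  _  AB refl refl = contradiction (AB refl) λ ()
cycle-choice {true}  {false} {false} {B = false} _  _  refl refl = inj₁ (refl , refl)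
cycle-choice {true}  {false} {true}  {B = false} _  _  refl refl = inj₂ (refl , refl)
cycle-choice {false} {true}          {B = false} _  AB refl refl = contradiction (AB refl) λ ()
cycle-choice {false} {true}  {true}  {B = true}  _  _  refl refl = inj₁ (refl , refl)
cycle-choice {false} {true}  {false} {B = true}  _  _  refl refl = inj₂ (refl , refl)
cycle-choice {false} {false} {true}              αβ _  refl refl = contradiction (αβ refl) λ ()
cycle-choice {false} {false} {false} {B = false} _  _  refl refl = inj₂ (refl , refl)
cycle-choice {false} {false} {false} {B = true}  _  _  refl refl = inj₁ (refl , refl)

module ThreeCycle {n} {x y z : Perm n} {p q r : Fin n} (p≢q : p ≢ q) (q≢r : q ≢ r) (p≢r : p ≢ r)
                  (y≡tx : Transposes p q x y) (z≡ty : Transposes q r y z) where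

  P Q R : Fin n
  P = x ⟨$⟩ˡ p
  Q = x ⟨$⟩ˡ q
  R = x ⟨$⟩ˡ r

  second-path-via-pr : (P ≺ R) ≡ (p ≺ r) → not (Q ≺ R) ≡ (p ≺ q) → SecondPath x y z
  second-path-via-pr PR≡pr ¬QR≡pq =
    y₁ , BEdge-fromAscent p≢r y₁≡tx PR≡pr , BEdge-fromAscent p≢q z≡ty₁ ascent , y≉y₁
    where
    y₁ : Perm n
    y₁ = x ∘ₚ transpose p r
    y₁≡tx : Transposes p r x y₁
    y₁≡tx = transposes λ _ → refl
    z≡ty₁ : Transposes p q y₁ z
    z≡ty₁ = transposes λ k → trans (pointwise z≡ty k)
      (trans (cong (PC.transpose q r) (pointwise y≡tx k)) (transpose-cycleˡ p≢q q≢r p≢r (x ⟨$⟩ʳ k)))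
    ascent : Ascent y₁ p q
    ascent = begin
      (y₁ ⟨$⟩ˡ p ≺ y₁ ⟨$⟩ˡ q) ≡⟨ cong₂ _≺_ (Transposes-⟨$⟩ˡ-matchˡ y₁≡tx) (Transposes-⟨$⟩ˡ-fixes y₁≡tx (p≢q ∘ sym) q≢r) ⟩
      (R ≺ Q)                ≡⟨ <ᵇ-flip (q≢r ∘ ⟨$⟩ˡ-injective x ∘ toℕ-injective) ⟩
      not (Q ≺ R)            ≡⟨ ¬QR≡pq ⟩
      (p ≺ q)                ∎
      where open ≡-Reasoning
    y≉y₁ : ¬ y ≈ y₁
    y≉y₁ y≈y₁ = q≢r (trans (sym (Transposes-matchˡ y≡tx)) (trans (y≈y₁ P) (Transposes-matchˡ y₁≡tx)))

  second-path-via-qr : (Q ≺ R) ≡ (q ≺ r) → (P ≺ Q) ≡ (p ≺ r) → SecondPath x y z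
  second-path-via-qr QR≡qr PQ≡pr =
    y₂ , BEdge-fromAscent q≢r y₂≡tx QR≡qr , BEdge-fromAscent p≢r z≡ty₂ ascent , y≉y₂
    where
    y₂ : Perm n
    y₂ = x ∘ₚ transpose q r
    y₂≡tx : Transposes q r x y₂
    y₂≡tx = transposes λ _ → refl
    z≡ty₂ : Transposes p r y₂ z
    z≡ty₂ = transposes λ k → trans (pointwise z≡ty k)
      (trans (cong (PC.transpose q r) (pointwise y≡tx k)) (transpose-cycleʳ p≢q q≢r p≢r (x ⟨$⟩ʳ k)))
    ascent : Ascent y₂ p r
    ascent = trans (cong₂ _≺_ (Transposes-⟨$⟩ˡ-fixes y₂≡tx p≢q p≢r) (Transposes-⟨$⟩ˡ-matchʳ y₂≡tx)) PQ≡pr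
    y≉y₂ : ¬ y ≈ y₂
    y≉y₂ y≈y₂ = p≢q (trans (sym (Transposes-fixes y₂≡tx p≢q p≢r)) (trans (sym (y≈y₂ P)) (Transposes-matchˡ y≡tx)))

  second-path : ℓ x < ℓ y → ℓ y < ℓ z → SecondPath x y z
  second-path x<y y<z = [ uncurry second-path-via-pr , uncurry second-path-via-qr ]′
    (cycle-choice (<ᵇ-median (toℕ p) (toℕ q) (toℕ r)) (<ᵇ-median (toℕ P) (toℕ Q) (toℕ R)) ascent-pq ascent-qr)
    where
    ascent-pq : (P ≺ Q) ≡ (p ≺ q)
    ascent-pq = Ascent-fromℓ< p≢q y≡tx x<y
    ascent-qr : (P ≺ R) ≡ (q ≺ r)
    ascent-qr = trans (cong₂ _≺_ (sym (Transposes-⟨$⟩ˡ-matchʳ y≡tx)) (sym (Transposes-⟨$⟩ˡ-fixes y≡tx (p≢r ∘ sym) (q≢r ∘ sym))))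
                      (Ascent-fromℓ< q≢r z≡ty y<z)

module Disjoint {n} {x y z : Perm n} {a b c d : Fin n} (a≢b : a ≢ b) (c≢d : c ≢ d)
                (a≢c : a ≢ c) (a≢d : a ≢ d) (b≢c : b ≢ c) (b≢d : b ≢ d)
                (y≡tx : Transposes a b x y) (z≡ty : Transposes c d y z) where

  second-path : ℓ x < ℓ y → ℓ y < ℓ z → SecondPath x y z
  second-path x<y y<z = y′ , BEdge-fromAscent c≢d y′≡tx ascent-cd , BEdge-fromAscent a≢b z≡ty′ ascent-ab , y≉y′
    where
    y′ : Perm n
    y′ = x ∘ₚ transpose c d
    y′≡tx : Transposes c d x y′
    y′≡tx = transposes λ _ → refl
    z≡ty′ : Transposes a b y′ z
    z≡ty′ = transposes λ k → trans (pointwise z≡ty k)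
      (trans (cong (PC.transpose c d) (pointwise y≡tx k)) (transpose-comm-disjoint a≢c a≢d b≢c b≢d (x ⟨$⟩ʳ k)))
    ascent-cd : Ascent x c d
    ascent-cd = trans (cong₂ _≺_ (sym (Transposes-⟨$⟩ˡ-fixes y≡tx (a≢c ∘ sym) (b≢c ∘ sym)))
                                 (sym (Transposes-⟨$⟩ˡ-fixes y≡tx (a≢d ∘ sym) (b≢d ∘ sym))))
                      (Ascent-fromℓ< c≢d z≡ty y<z)
    ascent-ab : Ascent y′ a b
    ascent-ab = trans (cong₂ _≺_ (Transposes-⟨$⟩ˡ-fixes y′≡tx a≢c a≢d) (Transposes-⟨$⟩ˡ-fixes y′≡tx b≢c b≢d))
                      (Ascent-fromℓ< a≢b y≡tx x<y)
    y≉y′ : ¬ y ≈ y′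
    y≉y′ y≈y′ = a≢b (trans (sym (Transposes-fixes y′≡tx a≢c a≢d)) (trans (sym (y≈y′ _)) (Transposes-matchˡ y≡tx)))

second-path-of-transpositions : ∀ {n} {x y z : Perm n} {a b c d} → a ≢ b → c ≢ d →
  Transposes a b x y → Transposes c d y z → ℓ x < ℓ y → ℓ y < ℓ z → SecondPath x y z
second-path-of-transpositions {x = x} {z = z} {a} {b} {c} {d} a≢b c≢d y≡tx z≡ty x<y y<z
  with c ≟ a | c ≟ b | d ≟ a | d ≟ b
... | yes refl | _        | _        | yes refl =
  contradiction (Transposes-twice y≡tx z≡ty) (ℓ<⇒≉ {x = x} {z} (<-trans x<y y<z))
... | yes refl | _        | _        | no d≢b   =
  ThreeCycle.second-path (a≢b ∘ sym) c≢d (d≢b ∘ sym) (Transposes-sym y≡tx) z≡ty x<y y<z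
... | no c≢a   | yes refl | yes refl | _        =
  contradiction (Transposes-twice (Transposes-sym y≡tx) z≡ty) (ℓ<⇒≉ {x = x} {z} (<-trans x<y y<z))
... | no c≢a   | yes refl | no d≢a   | _        =
  ThreeCycle.second-path a≢b c≢d (d≢a ∘ sym) y≡tx z≡ty x<y y<z
... | no c≢a   | no c≢b   | yes refl | _        =
  ThreeCycle.second-path (a≢b ∘ sym) (c≢d ∘ sym) (c≢b ∘ sym) (Transposes-sym y≡tx) (Transposes-sym z≡ty) x<y y<z
... | no c≢a   | no c≢b   | no d≢a   | yes refl =
  ThreeCycle.second-path a≢b (c≢d ∘ sym) (c≢a ∘ sym) y≡tx (Transposes-sym z≡ty) x<y y<z
... | no c≢a   | no c≢b   | no d≢a   | no d≢b   =
  Disjoint.second-path a≢b c≢d (c≢a ∘ sym) (d≢a ∘ sym) (c≢b ∘ sym) (d≢b ∘ sym) y≡tx z≡ty x<y y<z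

second-path : ∀ {n} {x y z : Perm n} → BEdge x y → BEdge y z → SecondPath x y z
second-path {x = x} {y} {z} ((a , b , a≢b , y≡tx) , x<y) ((c , d , c≢d , z≡ty) , y<z) =
  second-path-of-transpositions a≢b c≢d (transposes {x = x} {y} y≡tx) (transposes {x = y} {z} z≡ty) x<y y<z

-- Flips

suc≢inject₁ : ∀ {m} (e : Fin m) → suc e ≢ inject₁ e
suc≢inject₁ zero    ()
suc≢inject₁ (suc e) eq = suc≢inject₁ e (suc-injective eq)

module _ {n h} {u v : Perm n} {q : Seq n (suc h)} (q-path : IsPath (suc h) u v q) (e : Fin h) where

  private
    k : Fin (suc (suc h))
    k = suc (inject₁ e)

  IsPath-updateAt : ∀ {y′} → BEdge (q (inject₁ (inject₁ e))) y′ → BEdge y′ (q (suc (suc e))) →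
    IsPath (suc h) u v (updateAt q k (λ _ → y′))
  IsPath-updateAt {y′} into out = proj₁ q-path , end , edge
    where
    q′ : Seq n (suc h)
    q′ = updateAt q k (λ _ → y′)
    q′≡q : ∀ j → j ≢ k → q′ j ≡ q j
    q′≡q j j≢k = updateAt-minimal j k q j≢k
    end : q′ (fromℕ (suc h)) ≈ v
    end w = trans (cong (_⟨$⟩ʳ w) (q′≡q _ (fromℕ≢inject₁ ∘ suc-injective))) (proj₁ (proj₂ q-path) w)
    edge : ∀ d → BEdge (q′ (inject₁ d)) (q′ (suc d))
    edge d with d ≟ inject₁ e | d ≟ suc e
    ... | yes refl | _        =
      subst₂ BEdge (sym (q′≡q _ (suc≢inject₁ (inject₁ e) ∘ sym))) (sym (updateAt-updates k q)) into
    ... | no _     | yes refl =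
      subst₂ BEdge (sym (updateAt-updates k q)) (sym (q′≡q _ (suc≢inject₁ e ∘ suc-injective))) out
    ... | no d≢e   | no d≢1+e =
      subst₂ BEdge (sym (q′≡q _ (d≢1+e ∘ inject₁-injective))) (sym (q′≡q _ (d≢e ∘ suc-injective)))
             (proj₂ (proj₂ q-path) d)

  flip-exists : ∃[ q′ ] Flip (suc h) u v k q q′
  flip-exists with second-path {x = q (inject₁ (inject₁ e))} {q k} {q (suc (suc e))}
                               (proj₂ (proj₂ q-path) (inject₁ e)) (proj₂ (proj₂ q-path) (suc e))
  ... | y′ , into , out , qk≉y′ =
    updateAt q k (λ _ → y′) , q-path , IsPath-updateAt into out , s≤s z≤n , k<1+h
    , (λ j j≢k w → cong (_⟨$⟩ʳ w) (sym (updateAt-minimal j k q j≢k)))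
    , λ qk≈q′k → qk≉y′ λ w → trans (qk≈q′k w) (cong (_⟨$⟩ʳ w) (updateAt-updates k q))
    where
    k<1+h : toℕ k < suc h
    k<1+h = s≤s (subst (_< h) (sym (toℕ-inject₁ e)) (toℕ<n e))

record FlipClosedPaths {n} h (u v : Perm n) (F : Seq n h → Set) : Set where
  field
    paths  : ∀ {q} → F q → IsPath h u v q
    closed : ∀ {q q′} → F q → FlipStep h u v q q′ → F q′

open FlipClosedPaths

FlipClass-flipClosedPaths : ∀ {n h} {u v : Perm n} {p : Seq n h} → IsPath h u v p →
  FlipClosedPaths h u v (FlipClass h u v p)
FlipClass-flipClosedPaths {h = h} {u} {v} p-path = record
  { paths  = FlipClass⇒IsPath p-path
  ; closed = λ p⋆q step → p⋆q ◅◅ (step ◅ ε)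
  }
  where
  FlipClass⇒IsPath : ∀ {p q} → IsPath h u v p → FlipClass h u v p q → IsPath h u v q
  FlipClass⇒IsPath p-path ε                              = p-path
  FlipClass⇒IsPath _      ((_ , _ , q-path , _) ◅ steps) = FlipClass⇒IsPath q-path steps

flip-partner : ∀ {n h} {u v : Perm n} {F : Seq n (suc h) → Set} → FlipClosedPaths (suc h) u v F →
  ∀ {q} → F q → (e : Fin h) → ∃[ q′ ] (F q′ × Flip (suc h) u v (suc (inject₁ e)) q q′)
flip-partner {u = u} {v} F-closed {q} Fq e =
  let q′ , flip = flip-exists {u = u} {v} {q} (paths F-closed Fq) e
  in  q′ , closed F-closed Fq (_ , flip) , flip

flipClosed-InDeg≥2 : ∀ {n h} {u v : Perm n} {F : Seq n h → Set} → FlipClosedPaths h u v F →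
  ∀ x i → TSVertex F x i → 1 < toℕ i → InDeg≥2 F x i
flipClosed-InDeg≥2 _        _ zero          _                ()
flipClosed-InDeg≥2 _        _ (suc zero)    _                (s≤s ())
flipClosed-InDeg≥2 F-closed x (suc (suc e)) (q , Fq , qi≈x) _ with flip-partner F-closed Fq e
... | q′ , Fq′ , (_ , _ , _ , _ , q≈q′ , qk≉q′k) =
  q k , k , q′ k , k , qk≉q′k
  , (i≡1+k , q  , Fq  , (λ _ → refl) , qi≈x)
  , (i≡1+k , q′ , Fq′ , (λ _ → refl) , λ w → trans (sym (q≈q′ _ (suc≢inject₁ e ∘ suc-injective) w)) (qi≈x w))
  where
  k = suc (inject₁ e)
  i≡1+k : suc (suc (toℕ e)) ≡ suc (toℕ k)
  i≡1+k = cong (2 +_) (sym (toℕ-inject₁ e))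

flipClosed-OutDeg≥2 : ∀ {n h} {u v : Perm n} {F : Seq n h → Set} → FlipClosedPaths h u v F →
  ∀ x i → TSVertex F x i → toℕ i < h ∸ 1 → OutDeg≥2 F x i
flipClosed-OutDeg≥2 {h = suc h} F-closed x i (q , Fq , qi≈x) i<h with flip-partner F-closed Fq (fromℕ< i<h)
... | q′ , Fq′ , (_ , _ , _ , _ , q≈q′ , qk≉q′k) =
  q k , k , q′ k , k , qk≉q′k
  , (k≡1+i , q  , Fq  , qi≈x , λ _ → refl)
  , (k≡1+i , q′ , Fq′ , (λ w → trans (sym (q≈q′ i i≢k w)) (qi≈x w)) , λ _ → refl)
  where
  k = suc (inject₁ (fromℕ< i<h))
  k≡1+i : toℕ k ≡ suc (toℕ i)
  k≡1+i = cong suc (trans (toℕ-inject₁ _) (toℕ-fromℕ< i<h))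
  i≢k : i ≢ k
  i≢k i≡k = <-irrefl (cong toℕ i≡k) (subst (toℕ i <_) (sym k≡1+i) (n<1+n (toℕ i)))

lemma5p3 : ∀ {n : ℕ} (h : ℕ) (u v : Perm n) (p : Seq n h) → IsPath h u v p →
    (∀ (x : Perm n) (i : Fin (suc h)) → TSVertex (FlipClass h u v p) x i →
      1 < toℕ i → InDeg≥2 (FlipClass h u v p) x i)
    × (∀ (x : Perm n) (i : Fin (suc h)) → TSVertex (FlipClass h u v p) x i →
      toℕ i < h ∸ 1 → OutDeg≥2 (FlipClass h u v p) x i)
lemma5p3 h u v p p-path = flipClosed-InDeg≥2 F-closed , flipClosed-OutDeg≥2 F-closed
  where
  F-closed : FlipClosedPaths h u v (FlipClass h u v p)
  F-closed = FlipClass-flipClosedPaths p-path
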